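{- Let $k\ge 1$ be an integer, let $G$ be a graph with minimum degree at least $k$, and let $\Omega$ be a total $k$-coalition partition of $G$ of maximum cardinality (i.e. $|\Omega|=\mathrm{TC}_k(G)$). If $A\in\Omega$, then $A$ forms a total $k$-coalition with at most $\Delta(G)-k+1$ sets in $\Omega$.
   Context: All graphs are finite, simple and connected; $\Delta(G)$ is the maximum degree. For a vertex $v$, $N(v)$ denotes its open neighborhood. For a graph $G$ with $\delta(G)\ge k$, a set $S\subseteq V(G)$ is a total $k$-dominating set if $|N(v)\cap S|\ge k$ for every $v\in V(G)$. Two disjoint sets $U,W\subseteq V(G)$ form a total $k$-coalition if neither $U$ nor $W$ is a total $k$-dominating set but $U\cup W$ is a total $k$-dominating set. A total $k$-coalition partition of $G$ is a partition $\Omega$ of $V(G)$ such that every set of $\Omega$ forms a total $k$-coalition with some other set of $\Omega$. The total $k$-coalition number $\mathrm{TC}_k(G)$ is the maximum cardinality of a total $k$-coalition partition of $G$. -}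

module Defs where

open import Data.Nat using (ℕ; zero; suc; _+_; _≤_; _⊔_)
open import Data.Bool using (Bool; true; false; _∧_; _∨_; if_then_else_)
open import Data.Fin using (Fin; _≟_)
open import Data.List using (List; map; foldr; allFin)
open import Data.Nat.ListAction using (sum)
open import Data.Product using (Σ; _×_; ∃)
open import Relation.Nullary using (¬_; ⌊_⌋)
open import Relation.Binary.PropositionalEquality using (_≡_; _≢_)

record Graph (n : ℕ) : Set where
  field
    adj    : Fin n → Fin n → Bool
    sym    : ∀ u v → adj u v ≡ adj v u
    irrefl : ∀ v → adj v v ≡ false
open Graph public

data Reach {n : ℕ} (G : Graph n) : Fin n → Fin n → Set where
  here : ∀ {u} → Reach G u u
  step : ∀ {u w v} → adj G u w ≡ true → Reach G w v → Reach G u v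

Connected : {n : ℕ} → Graph n → Set
Connected G = ∀ u v → Reach G u v

count : {n : ℕ} → (Fin n → Bool) → ℕ
count {n} p = sum (map (λ v → if p v then 1 else 0) (allFin n))

deg : {n : ℕ} → Graph n → Fin n → ℕ
deg G v = count (adj G v)

maxDeg : {n : ℕ} → Graph n → ℕ
maxDeg {n} G = foldr _⊔_ 0 (map (deg G) (allFin n))

MinDegAtLeast : {n : ℕ} → ℕ → Graph n → Set
MinDegAtLeast k G = ∀ v → k ≤ deg G v

VSet : ℕ → Set
VSet n = Fin n → Bool

_∪_ : {n : ℕ} → VSet n → VSet n → VSet n
(U ∪ W) v = U v ∨ W v

TotalKDom : {n : ℕ} → ℕ → Graph n → VSet n → Set
TotalKDom k G S = ∀ v → k ≤ count (λ u → adj G v u ∧ S u)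

-- U, W form a total k-coalition (disjointness is ensured by usage on distinct parts)
TotalKCoalition : {n : ℕ} → ℕ → Graph n → VSet n → VSet n → Set
TotalKCoalition k G U W =
  ¬ TotalKDom k G U × ¬ TotalKDom k G W × TotalKDom k G (U ∪ W)

-- A partition of V(G) into m (nonempty) parts is given by a class map cls : Fin n → Fin m
-- that is surjective; part i = cls⁻¹(i).
part : {n m : ℕ} → (Fin n → Fin m) → Fin m → VSet n
part cls i v = ⌊ cls v ≟ i ⌋

IsPartition : {n m : ℕ} → (Fin n → Fin m) → Set
IsPartition {n} cls = ∀ i → ∃ λ (v : Fin n) → cls v ≡ i

IsTotalKCoalitionPartition : {n : ℕ} → ℕ → Graph n → (m : ℕ) → (Fin n → Fin m) → Set
IsTotalKCoalitionPartition k G m cls =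
  IsPartition cls ×
  (∀ i → ∃ λ j → j ≢ i × TotalKCoalition k G (part cls i) (part cls j))

IsMaxTotalKCoalitionPartition : {n : ℕ} → ℕ → Graph n → (m : ℕ) → (Fin n → Fin m) → Set
IsMaxTotalKCoalitionPartition {n} k G m cls =
  IsTotalKCoalitionPartition k G m cls ×
  (∀ (m' : ℕ) (cls' : Fin n → Fin m') → IsTotalKCoalitionPartition k G m' cls' → m' ≤ m)

-- Since A is not total k-dominating, some vertex v has a < k neighbours in A.  Every
-- partner B of A makes A ∪ B total k-dominating, so v has at least k - a ≥ 1 neighbours
-- in B.  The partners are distinct parts other than A, hence pairwise disjoint and disjoint
-- from A, so t partners give deg v ≥ a + (k - a) + (t - 1) = k + t - 1.
module Submission where

open import Defs hiding (sym)
open import Data.Bool using (Bool; true; false; _∧_; _∨_; if_then_else_)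
open import Data.Bool.Properties using (∨-idem)
open import Data.Empty using (⊥-elim)
open import Data.Fin using (Fin; zero; suc; _≟_)
open import Data.Fin.Properties using (¬∀⟶∃¬; suc-injective)
open import Data.List using (tabulate; foldr)
open import Data.List.Properties using (map-tabulate)
import Data.Nat.ListAction as List
open import Data.Nat using (ℕ; zero; suc; _+_; _∸_; _⊔_; _≤_; _<_; z≤n; s≤s; _≤?_)
open import Data.Nat.Properties
  using ( ≤-reflexive; ≤-trans; +-mono-≤; +-monoˡ-≤; +-monoʳ-≤; +-comm; +-assoc
        ; m≤m⊔n; m≤n⊔m; ≰⇒>; <⇒≤; m<n⇒0<n∸m; m+[n∸m]≡n; m≤n+o⇒m∸n≤o; m+n≤o⇒m≤o∸n
        ; +-0-commutativeMonoid; module ≤-Reasoning )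
open import Algebra.Properties.CommutativeMonoid.Sum +-0-commutativeMonoid
  using (sum-syntax; sum-cong-≋; sum-replicate-zero; ∑-comm; ∑-distrib-+)
open import Data.Product using (∃; _,_; proj₁; proj₂)
open import Data.Vec.Functional using (_∷_)
open import Function.Definitions using (Injective)
open import Relation.Binary.PropositionalEquality using (_≡_; _≢_; refl; sym; cong; subst)
open import Relation.Nullary using (¬_; ⌊_⌋; yes; no)

𝟙 : Bool → ℕ
𝟙 b = if b then 1 else 0

∑-mono-≤ : ∀ {n} {g h : Fin n → ℕ} → (∀ i → g i ≤ h i) → ∑[ i < n ] g i ≤ ∑[ i < n ] h i
∑-mono-≤ {zero}  g≤h = z≤n
∑-mono-≤ {suc n} g≤h = +-mono-≤ (g≤h zero) (∑-mono-≤ (λ i → g≤h (suc i)))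

∑-lowerBound : ∀ {t c} (g : Fin (suc t) → ℕ) → 1 ≤ c → (∀ i → c ≤ g i) →
               c + t ≤ ∑[ i < suc t ] g i
∑-lowerBound {t} g 1≤c c≤g = +-mono-≤ (c≤g zero) t≤∑
  where
  sum-replicate-1 : ∀ t → ∑[ i < t ] 1 ≡ t
  sum-replicate-1 zero    = refl
  sum-replicate-1 (suc t) = cong suc (sum-replicate-1 t)
  t≤∑ : t ≤ ∑[ i < t ] g (suc i)
  t≤∑ = ≤-trans (≤-reflexive (sym (sum-replicate-1 t))) (∑-mono-≤ (λ i → ≤-trans 1≤c (c≤g (suc i))))

injective-hits≤1 : ∀ {m t} (f : Fin t → Fin m) → Injective _≡_ _≡_ f →
                   ∀ x → ∑[ s < t ] 𝟙 ⌊ x ≟ f s ⌋ ≤ 1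
injective-hits≤1 {t = zero}  f inj x = z≤n
injective-hits≤1 {t = suc t} f inj x with x ≟ f zero
... | no _     = injective-hits≤1 (λ s → f (suc s)) (λ e → suc-injective (inj e)) x
... | yes x≡f₀ = s≤s (≤-trans (∑-mono-≤ miss) (≤-reflexive (sum-replicate-zero t)))
  where
  miss : ∀ s → 𝟙 ⌊ x ≟ f (suc s) ⌋ ≤ 0
  miss s with x ≟ f (suc s)
  ... | no _      = z≤n
  ... | yes x≡fₛ with inj (subst (_≡ f (suc s)) x≡f₀ x≡fₛ)
  ...   | ()

sum-tabulate : ∀ {n} (h : Fin n → ℕ) → List.sum (tabulate h) ≡ ∑[ i < n ] h i
sum-tabulate {zero}  h = refl
sum-tabulate {suc n} h = cong (h zero +_) (sum-tabulate (λ i → h (suc i)))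

count≡∑ : ∀ {n} (p : VSet n) → count p ≡ ∑[ u < n ] 𝟙 (p u)
count≡∑ {n} p rewrite map-tabulate (λ v → v) (λ v → 𝟙 (p v)) = sum-tabulate (λ u → 𝟙 (p u))

count-cong : ∀ {n} {p q : VSet n} → (∀ u → p u ≡ q u) → count p ≡ count q
count-cong {p = p} {q} p≗q rewrite count≡∑ p | count≡∑ q = sum-cong-≋ (λ u → cong 𝟙 (p≗q u))

count-∧-∪ : ∀ {n} (p U W : VSet n) →
            count (λ u → p u ∧ (U ∪ W) u) ≤ count (λ u → p u ∧ U u) + count (λ u → p u ∧ W u)
count-∧-∪ {n} p U W
  rewrite count≡∑ (λ u → p u ∧ (U ∪ W) u) | count≡∑ (λ u → p u ∧ U u) | count≡∑ (λ u → p u ∧ W u)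
  = ≤-trans (∑-mono-≤ pointwise) (≤-reflexive (∑-distrib-+ {n} (λ u → 𝟙 (p u ∧ U u)) _))
  where
  pointwise : ∀ u → 𝟙 (p u ∧ (U u ∨ W u)) ≤ 𝟙 (p u ∧ U u) + 𝟙 (p u ∧ W u)
  pointwise u with p u | U u | W u
  ... | false | _     | _     = z≤n
  ... | true  | true  | _     = s≤s z≤n
  ... | true  | false | true  = s≤s z≤n
  ... | true  | false | false = z≤n

count-∧-parts≤count : ∀ {n m t} (cls : Fin n → Fin m) (f : Fin t → Fin m) → Injective _≡_ _≡_ f →
                      (p : VSet n) → ∑[ s < t ] count (λ u → p u ∧ part cls (f s) u) ≤ count p
count-∧-parts≤count {n} {t = t} cls f inj p = begin
  ∑[ s < t ] count (λ u → p u ∧ part cls (f s) u)      ≡⟨ sum-cong-≋ {t} (λ s → count≡∑ (λ u → p u ∧ part cls (f s) u)) ⟩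
  ∑[ s < t ] ∑[ u < n ] 𝟙 (p u ∧ part cls (f s) u)     ≡⟨ ∑-comm {t} {n} _ ⟩
  ∑[ u < n ] ∑[ s < t ] 𝟙 (p u ∧ part cls (f s) u)     ≤⟨ ∑-mono-≤ pointwise ⟩
  ∑[ u < n ] 𝟙 (p u)                                   ≡⟨ sym (count≡∑ p) ⟩
  count p                                              ∎
  where
  open ≤-Reasoning
  pointwise : ∀ u → ∑[ s < t ] 𝟙 (p u ∧ part cls (f s) u) ≤ 𝟙 (p u)
  pointwise u with p u
  ... | false = ≤-reflexive (sum-replicate-zero t)
  ... | true  = injective-hits≤1 f inj (cls u)

deg≤maxDeg : ∀ {n} (G : Graph n) v → deg G v ≤ maxDeg G
deg≤maxDeg {n} G v rewrite map-tabulate (λ u → u) (deg G) = lookup≤foldr-⊔ (deg G) v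
  where
  lookup≤foldr-⊔ : ∀ {n} (g : Fin n → ℕ) i → g i ≤ foldr _⊔_ 0 (tabulate g)
  lookup≤foldr-⊔ g zero    = m≤m⊔n _ _
  lookup≤foldr-⊔ g (suc i) = ≤-trans (lookup≤foldr-⊔ (λ j → g (suc j)) i) (m≤n⊔m (g zero) _)

∷-injective : ∀ {m t} {x : Fin m} {f : Fin t → Fin m} →
              (∀ s → f s ≢ x) → Injective _≡_ _≡_ f → Injective _≡_ _≡_ (x ∷ f)
∷-injective f≢x inj {zero}  {zero}  _ = refl
∷-injective f≢x inj {zero}  {suc s} e = ⊥-elim (f≢x s (sym e))
∷-injective f≢x inj {suc s} {zero}  e = ⊥-elim (f≢x s e)
∷-injective f≢x inj {suc s} {suc r} e = cong suc (inj e)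

module _ {n : ℕ} (k : ℕ) (G : Graph n) where

  undominated : ∀ {S} → ¬ TotalKDom k G S → ∃ λ v → count (λ u → adj G v u ∧ S u) < k
  undominated {S} ¬dom with ¬∀⟶∃¬ n _ (λ v → k ≤? count (λ u → adj G v u ∧ S u)) ¬dom
  ... | v , k≰ = v , ≰⇒> k≰

  ¬TotalKCoalition-self : ∀ S → ¬ TotalKCoalition k G S S
  ¬TotalKCoalition-self S (¬dom , _ , dom) =
    ¬dom (λ v → subst (k ≤_) (count-cong (λ u → cong (adj G v u ∧_) (∨-idem (S u)))) (dom v))

  partner-≢ : ∀ {m} (cls : Fin n → Fin m) {i j} → TotalKCoalition k G (part cls i) (part cls j) → j ≢ i
  partner-≢ cls {i} coal refl = ¬TotalKCoalition-self (part cls i) coal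

  coalition-partners-bound :
    ∀ {m t} (cls : Fin n → Fin m) (i : Fin m) (f : Fin (suc t) → Fin m) → Injective _≡_ _≡_ f →
    (∀ s → TotalKCoalition k G (part cls i) (part cls (f s))) →
    ∀ v → count (λ u → adj G v u ∧ part cls i u) < k → k + t ≤ deg G v
  coalition-partners-bound {t = t} cls i f inj coal v a<k = begin
    k + t                                             ≡⟨ cong (_+ t) (sym (m+[n∸m]≡n (<⇒≤ a<k))) ⟩
    (a + (k ∸ a)) + t                                 ≡⟨ +-assoc a (k ∸ a) t ⟩
    a + ((k ∸ a) + t)                                 ≤⟨ +-monoʳ-≤ a (∑-lowerBound neighbours (m<n⇒0<n∸m a<k) k∸a≤) ⟩
    ∑[ s < suc (suc t) ] neighboursIn ((i ∷ f) s)     ≤⟨ count-∧-parts≤count cls (i ∷ f) i∷f-inj (adj G v) ⟩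
    deg G v                                           ∎
    where
    open ≤-Reasoning
    neighboursIn : Fin _ → ℕ
    neighboursIn j = count (λ u → adj G v u ∧ part cls j u)
    a = neighboursIn i
    neighbours : Fin (suc t) → ℕ
    neighbours s = neighboursIn (f s)
    k∸a≤ : ∀ s → k ∸ a ≤ neighbours s
    k∸a≤ s = m≤n+o⇒m∸n≤o k a (≤-trans (proj₂ (proj₂ (coal s)) v) (count-∧-∪ (adj G v) _ _))
    i∷f-inj : Injective _≡_ _≡_ (i ∷ f)
    i∷f-inj = ∷-injective (λ s → partner-≢ cls (coal s)) inj

lemma3p3 : (k n : ℕ) → 1 ≤ k → (G : Graph n) → Connected G → MinDegAtLeast k G →
    (m : ℕ) (cls : Fin n → Fin m) → IsMaxTotalKCoalitionPartition k G m cls →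
    (i : Fin m) →
    (t : ℕ) (f : Fin t → Fin m) → Injective _≡_ _≡_ f →
    (∀ s → TotalKCoalition k G (part cls i) (part cls (f s))) →
    t ≤ maxDeg G ∸ k + 1
lemma3p3 k n _ G _ _ m cls _ i zero    f inj coal = z≤n
lemma3p3 k n _ G _ _ m cls _ i (suc t) f inj coal
  with v , a<k ← undominated k G (proj₁ (coal zero)) =
  subst (_≤ maxDeg G ∸ k + 1) (+-comm t 1) (+-monoˡ-≤ 1 t≤Δ∸k)
  where
  k+t≤Δ : k + t ≤ maxDeg G
  k+t≤Δ = ≤-trans (coalition-partners-bound k G cls i f inj coal v a<k) (deg≤maxDeg G v)
  t≤Δ∸k : t ≤ maxDeg G ∸ k
  t≤Δ∸k = m+n≤o⇒m≤o∸n t (subst (_≤ maxDeg G) (+-comm k t) k+t≤Δ)
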